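{- Let $n,m,r$ be non-negative integers and $p$ a prime number. Then $$\sum_{k=0}^{p-1}(-m)_{p-1-k}\,(x+1)^k\,\mathcal{F}_n(x;r+m,k)\equiv -r^n\,\mathcal{T}_{p-1}(x;m)\pmod{p\mathbb{Z}_p[x]}.$$
   Context: $(\alpha)_j=\alpha(\alpha-1)\cdots(\alpha-j+1)$ for $j\ge1$, $(\alpha)_0=1$. ${n\brace k}_r$ denotes the $r$-Stirling numbers of the second kind: the number of partitions of $\{1,\dots,n\}$ into $k$ nonempty blocks such that $1,\dots,r$ lie in distinct blocks. The $(r,s)$-Fubini polynomials are $\mathcal{F}_n(x;r,s)=\sum_{k=0}^n {n+r\brace k+r}_r (k+s)!\,x^k$. The polynomials $\mathcal{T}_n$ are $\mathcal{T}_n(x;r)=\sum_{j=0}^n\binom{n+r}{j+r}x^j$. Convention $0^0=1$. $A\equiv B\pmod{p\mathbb{Z}_p[x]}$ means corresponding coefficients are congruent modulo $p$. -}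

module Defs where

open import Data.Nat as ℕ using (ℕ; zero; suc; _≤ᵇ_; _≡ᵇ_)
open import Data.Nat.Combinatorics using (_C_)
open import Data.Nat using (_!)
open import Data.Integer as ℤ using (ℤ; +_; _-_; _*_; _+_; -_)
open import Data.Bool using (Bool; true; false; if_then_else_; _∧_)

-- Polynomials in x with integer coefficients, as coefficient functions:
-- (P i) is the coefficient of x^i.
Poly : Set
Poly = ℕ → ℤ

sumTo : ℕ → (ℕ → ℤ) → ℤ
sumTo zero    f = f zero
sumTo (suc n) f = sumTo n f + f (suc n)

sumBelow : ℕ → (ℕ → ℤ) → ℤ
sumBelow zero    f = + 0
sumBelow (suc n) f = sumBelow n f + f n

padd : Poly → Poly → Poly
padd P Q i = P i + Q i

pmul : Poly → Poly → Poly
pmul P Q i = sumTo i (λ a → P a * Q (i ℕ.∸ a))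

pscale : ℤ → Poly → Poly
pscale c P i = c * P i

psumBelow : ℕ → (ℕ → Poly) → Poly
psumBelow n P i = sumBelow n (λ k → P k i)

xPlus1Pow : ℕ → Poly
xPlus1Pow k a = + (k C a)

fall : ℤ → ℕ → ℤ
fall α zero    = + 1
fall α (suc j) = fall α j * (α - + j)

-- r-Stirling numbers of the second kind {n brace k}_r (Broder), via the
-- standard characterisation: 0 for n < r, δ_{k,r} for n = r, and
-- {n brace k}_r = k {n-1 brace k}_r + {n-1 brace k-1}_r for n > r.
rStirling2 : ℕ → ℕ → ℕ → ℕ
rStirling2 r zero    k = if (r ≡ᵇ 0) ∧ (k ≡ᵇ 0) then 1 else 0
rStirling2 r (suc n) k =
  if suc n ≤ᵇ r
  then (if (suc n ≡ᵇ r) ∧ (k ≡ᵇ r) then 1 else 0)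
  else (k ℕ.* rStirling2 r n k ℕ.+ pred-term k)
  where
  pred-term : ℕ → ℕ
  pred-term zero    = 0
  pred-term (suc k') = rStirling2 r n k'

fubini : ℕ → ℕ → ℕ → Poly
fubini n r s k =
  if k ≤ᵇ n then + (rStirling2 r (n ℕ.+ r) (k ℕ.+ r) ℕ.* (k ℕ.+ s) !) else + 0

Tpoly : ℕ → ℕ → Poly
Tpoly n r j = if j ≤ᵇ n then + ((n ℕ.+ r) C (j ℕ.+ r)) else + 0

open import Data.Integer.Divisibility using (_∣_)

_≡ₚ_[mod_] : Poly → Poly → ℕ → Set
P ≡ₚ Q [mod p ] = ∀ i → (+ p) ∣ (P i - Q i)

{-# OPTIONS --safe #-}
module Submission where

-- Write a j = (-m)_{p-1-j} and Q n j = (x+1)^j F_n(x; r+m, j), so that the left-hand side is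
-- L n = Σ_{j<p} a j · Q n j. The recurrence of the r-Stirling numbers gives
-- F_{n+1}(x; r, s) = (1+x) F_n(x; r, s+1) + (r-s-1) F_n(x; r, s), that is
-- Q (n+1) j = Q n (j+1) + (r+m-j-1) Q n j. Summing by parts against a, the boundary terms vanish
-- mod p (p divides (-m)_p and every coefficient of F_n(x; r+m, p)), and
-- (-m)_{p-j} + (r+m-j-1) a j = (r-p) a j, so L (n+1) ≡ r L n.
-- For n = 0, F_0(x; r+m, j) = j!, and Wilson's theorem gives (-m)_t (p-1-t)! ≡ -C(m+t-1, t), so
-- L 0 ≡ -Σ_t C(m+t-1, t) (x+1)^{p-1-t}, whose coefficients are -C(p-1+m, i+m) by a
-- Vandermonde-type convolution.

open import Defs

-- A separate module keeps the integer operators opened here out of scope of theorem18's statement,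
-- which uses those of ℕ.
module Proof where

  open import Data.Bool using (true; false; if_then_else_; _∧_)
  open import Data.Integer as ℤ using (ℤ; +_; -_; _+_; _-_; _*_; _^_; -1ℤ)
  import Data.Integer.Properties as ℤ
  import Data.Integer.Divisibility as Unsigned
  open import Data.Integer.Divisibility.Signed
    using (_∣_; divides; ∣m⇒∣-m; ∣m∣n⇒∣m+n; ∣n⇒∣m*n; ∣ᵤ⇒∣; ∣⇒∣ᵤ)
  open import Data.Integer.Tactic.RingSolver using (solve-∀)
  open import Data.Nat as ℕ using (ℕ; zero; suc; _∸_; _!; _<_; _≤_; z≤n; s≤s; _≤ᵇ_; _≡ᵇ_)
  import Data.Nat.Properties as ℕ
  import Data.Nat.Divisibility as ℕ
  open import Data.Nat.DivMod using (m/n*n≡m)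
  open import Data.Nat.Combinatorics
    using ( _C_; nCk+nC[k+1]≡[n+1]C[k+1]; k>n⇒nCk≡0; nC1≡n; nCn≡1; nCk≡nC[n∸k]
          ; nCk≡n!/k![n-k]!; k![n∸k]!∣n!)
  open import Data.Nat.Primality using (Prime; euclidsLemma; prime⇒nonTrivial)
  open import Data.Nat.Tactic.RingSolver using () renaming (solve-∀ to ℕ-solve-∀)
  open import Data.Sum using (inj₁; inj₂)
  open import Function using (_∘′_)
  open import Relation.Binary.Bundles using (Setoid)
  open import Relation.Binary.Structures using (IsEquivalence)
  open import Relation.Binary.PropositionalEquality
  import Relation.Binary.Reasoning.Setoid as SetoidReasoning
  open import Relation.Nullary using (yes; no; contradiction)

  sumBelow-cong : ∀ n {f g : ℕ → ℤ} → (∀ k → k < n → f k ≡ g k) → sumBelow n f ≡ sumBelow n g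
  sumBelow-cong zero    f≡g = refl
  sumBelow-cong (suc n) f≡g =
    cong₂ _+_ (sumBelow-cong n λ k k<n → f≡g k (ℕ.m<n⇒m<1+n k<n)) (f≡g n (ℕ.n<1+n n))

  sumBelow-zero : ∀ n {f : ℕ → ℤ} → (∀ k → k < n → f k ≡ + 0) → sumBelow n f ≡ + 0
  sumBelow-zero zero    f≡0 = refl
  sumBelow-zero (suc n) f≡0 =
    cong₂ _+_ (sumBelow-zero n λ k k<n → f≡0 k (ℕ.m<n⇒m<1+n k<n)) (f≡0 n (ℕ.n<1+n n))

  sumBelow-+ : ∀ n (f g : ℕ → ℤ) → sumBelow n (λ k → f k + g k) ≡ sumBelow n f + sumBelow n g
  sumBelow-+ zero    f g = refl
  sumBelow-+ (suc n) f g =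
    trans (cong (_+ (f n + g n)) (sumBelow-+ n f g)) (interchange (sumBelow n f) (sumBelow n g) (f n) (g n))
    where
    interchange : ∀ a b c d → a + b + (c + d) ≡ a + c + (b + d)
    interchange = solve-∀

  sumBelow-*ˡ : ∀ n c (f : ℕ → ℤ) → sumBelow n (λ k → c * f k) ≡ c * sumBelow n f
  sumBelow-*ˡ zero    c f = sym (ℤ.*-zeroʳ c)
  sumBelow-*ˡ (suc n) c f = trans (cong (_+ c * f n) (sumBelow-*ˡ n c f)) (sym (ℤ.*-distribˡ-+ c _ _))

  sumBelow-const : ∀ n c → sumBelow n (λ _ → c) ≡ + n * c
  sumBelow-const zero    c = refl
  sumBelow-const (suc n) c = trans (cong (_+ c) (sumBelow-const n c)) (step (+ n) c)
    where
    step : ∀ n c → n * c + c ≡ (+ 1 + n) * c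
    step = solve-∀

  sumBelow-sucˡ : ∀ n (f : ℕ → ℤ) → sumBelow (suc n) f ≡ f 0 + sumBelow n (λ k → f (suc k))
  sumBelow-sucˡ zero    f = ℤ.+-comm (+ 0) (f 0)
  sumBelow-sucˡ (suc n) f =
    trans (cong (_+ f (suc n)) (sumBelow-sucˡ n f)) (ℤ.+-assoc (f 0) _ (f (suc n)))

  sumBelow-shift : ∀ n (f : ℕ → ℤ) → sumBelow n (λ k → f (suc k)) ≡ sumBelow n f + f n - f 0
  sumBelow-shift n f = trans (sym (cancel (f 0) _)) (cong (_- f 0) (sym (sumBelow-sucˡ n f)))
    where
    cancel : ∀ x y → x + y - x ≡ y
    cancel = solve-∀

  sumBelow-reverse : ∀ n (f : ℕ → ℤ) → sumBelow n f ≡ sumBelow n (λ k → f (n ∸ suc k))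
  sumBelow-reverse zero    f = refl
  sumBelow-reverse (suc n) f = begin
    sumBelow n f + f n                          ≡⟨ cong (_+ f n) (sumBelow-reverse n f) ⟩
    sumBelow n (λ k → f (n ∸ suc k)) + f n      ≡⟨ ℤ.+-comm _ (f n) ⟩
    f n + sumBelow n (λ k → f (n ∸ suc k))      ≡⟨ sumBelow-sucˡ n (λ k → f (n ∸ k)) ⟨
    sumBelow (suc n) (λ k → f (n ∸ k))          ∎
    where open ≡-Reasoning

  sumTo≡sumBelow : ∀ n (f : ℕ → ℤ) → sumTo n f ≡ sumBelow (suc n) f
  sumTo≡sumBelow zero    f = sym (ℤ.+-identityˡ (f 0))
  sumTo≡sumBelow (suc n) f = cong (_+ f (suc n)) (sumTo≡sumBelow n f)

  C-pascal : ∀ n k → suc n C suc k ≡ n C k ℕ.+ n C suc k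
  C-pascal n k = sym (nCk+nC[k+1]≡[n+1]C[k+1] n k)

  C-absorb : ∀ n k → suc k ℕ.* (suc n C suc k) ≡ suc n ℕ.* (n C k)
  C-absorb n       zero    =
    trans (ℕ.*-identityˡ (suc n C 1)) (trans (nC1≡n (suc n)) (sym (ℕ.*-identityʳ (suc n))))
  C-absorb zero    (suc k) =
    trans (cong (suc (suc k) ℕ.*_) (k>n⇒nCk≡0 (s≤s (s≤s (z≤n {k}))))) (ℕ.*-zeroʳ (suc (suc k)))
  C-absorb (suc n) (suc k) = begin
    suc (suc k) ℕ.* (suc (suc n) C suc (suc k))
      ≡⟨ cong (suc (suc k) ℕ.*_) (C-pascal (suc n) (suc k)) ⟩
    suc (suc k) ℕ.* (A ℕ.+ B)
      ≡⟨ expand k A B ⟩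
    A ℕ.+ suc k ℕ.* A ℕ.+ suc (suc k) ℕ.* B
      ≡⟨ cong₂ (λ x y → A ℕ.+ x ℕ.+ y) (C-absorb n k) (C-absorb n (suc k)) ⟩
    A ℕ.+ suc n ℕ.* (n C k) ℕ.+ suc n ℕ.* (n C suc k)
      ≡⟨ ℕ.+-assoc A (suc n ℕ.* (n C k)) (suc n ℕ.* (n C suc k)) ⟩
    A ℕ.+ (suc n ℕ.* (n C k) ℕ.+ suc n ℕ.* (n C suc k))
      ≡⟨ cong (A ℕ.+_) (ℕ.*-distribˡ-+ (suc n) (n C k) (n C suc k)) ⟨
    A ℕ.+ suc n ℕ.* (n C k ℕ.+ n C suc k)
      ≡⟨ cong (λ x → A ℕ.+ suc n ℕ.* x) (C-pascal n k) ⟨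
    suc (suc n) ℕ.* A
      ∎
    where
    open ≡-Reasoning
    A = suc n C suc k
    B = suc n C suc (suc k)
    expand : ∀ k A B → (2 ℕ.+ k) ℕ.* (A ℕ.+ B) ≡ A ℕ.+ (1 ℕ.+ k) ℕ.* A ℕ.+ (2 ℕ.+ k) ℕ.* B
    expand = ℕ-solve-∀

  C*factorials≡factorial : ∀ {n k} → k ≤ n → (n C k) ℕ.* (k ! ℕ.* (n ∸ k) !) ≡ n !
  C*factorials≡factorial {n} {k} k≤n =
    trans (cong (ℕ._* (k ! ℕ.* (n ∸ k) !)) (nCk≡n!/k![n-k]! k≤n)) (m/n*n≡m (k![n∸k]!∣n! k≤n))
    where instance _ = k ℕ.!* (n ∸ k) !≢0

  binomial : ∀ n x → (+ 1 + x) ^ n ≡ sumBelow (suc n) (λ i → + (n C i) * x ^ i)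
  binomial zero    x = refl
  binomial (suc n) x = sym (begin
    sumBelow (suc (suc n)) (λ i → + (suc n C i) * x ^ i)
      ≡⟨ sumBelow-sucˡ (suc n) _ ⟩
    + 1 + sumBelow (suc n) (λ i → + (suc n C suc i) * x ^ suc i)
      ≡⟨ cong (λ y → + 1 + y) (sumBelow-cong (suc n) (λ i _ → pascal i)) ⟩
    + 1 + sumBelow (suc n) (λ i → x * f i + f (suc i))
      ≡⟨ cong (λ y → + 1 + y) (sumBelow-+ (suc n) (λ i → x * f i) (λ i → f (suc i))) ⟩
    + 1 + (sumBelow (suc n) (λ i → x * f i) + T)
      ≡⟨ cong (λ y → + 1 + (y + T)) (sumBelow-*ˡ (suc n) x f) ⟩
    + 1 + (x * S + sumBelow (suc n) (λ i → f (suc i)))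
      ≡⟨ regroup (x * S) T ⟩
    x * S + (+ 1 + sumBelow (suc n) (λ i → f (suc i)))
      ≡⟨ cong (λ y → x * S + y) (sumBelow-sucˡ (suc n) f) ⟨
    x * S + (S + f (suc n))
      ≡⟨ cong (λ c → x * S + (S + + c * x ^ suc n)) (k>n⇒nCk≡0 (ℕ.n<1+n n)) ⟩
    x * S + (S + + 0 * x ^ suc n)
      ≡⟨ factor x S (x ^ suc n) ⟩
    (+ 1 + x) * S
      ≡⟨ cong ((+ 1 + x) *_) (binomial n x) ⟨
    (+ 1 + x) * (+ 1 + x) ^ n
      ∎)
    where
    open ≡-Reasoning
    f : ℕ → ℤ
    f i = + (n C i) * x ^ i
    S = sumBelow (suc n) f
    T = sumBelow (suc n) (λ i → f (suc i))
    pascal : ∀ i → + (suc n C suc i) * x ^ suc i ≡ x * f i + f (suc i)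
    pascal i = trans (cong (λ c → + c * x ^ suc i) (C-pascal n i)) (spread (+ (n C i)) (+ (n C suc i)) x (x ^ i))
      where
      spread : ∀ a b x y → (a + b) * (x * y) ≡ x * (a * y) + b * (x * y)
      spread = solve-∀
    regroup : ∀ a b → + 1 + (a + b) ≡ a + (+ 1 + b)
    regroup = solve-∀
    factor : ∀ x S y → x * S + (S + + 0 * y) ≡ (+ 1 + x) * S
    factor = solve-∀

  -- C(t+m-1, t); the truncated subtraction is harmless, giving 1 at t = m = 0.
  multichoose : ℕ → ℕ → ℕ
  multichoose m t = (t ℕ.+ m ∸ 1) C t

  multichoose-absorb : ∀ m t → suc t ℕ.* multichoose m (suc t) ≡ (t ℕ.+ m) ℕ.* multichoose m t
  multichoose-absorb m t = absorb (t ℕ.+ m)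
    where
    absorb : ∀ N → suc t ℕ.* (N C suc t) ≡ N ℕ.* ((N ∸ 1) C t)
    absorb zero    = ℕ.*-zeroʳ (suc t)
    absorb (suc N) = C-absorb N t

  multichoose-hockeyStick : ∀ m N → (N ℕ.+ m) C m ℕ.+ multichoose m (suc N) ≡ (suc N ℕ.+ m) C m
  multichoose-hockeyStick zero    N = cong suc (k>n⇒nCk≡0 (s≤s (ℕ.≤-reflexive (ℕ.+-identityʳ N))))
  multichoose-hockeyStick (suc m) N = begin
    X C suc m ℕ.+ X C suc N    ≡⟨ cong (X C suc m ℕ.+_) complement ⟩
    X C suc m ℕ.+ X C m        ≡⟨ ℕ.+-comm (X C suc m) (X C m) ⟩
    X C m ℕ.+ X C suc m        ≡⟨ C-pascal X m ⟨
    suc X C suc m              ∎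
    where
    open ≡-Reasoning
    X = N ℕ.+ suc m
    complement : X C suc N ≡ X C m
    complement = trans (nCk≡nC[n∸k] (subst (suc N ≤_) (sym (ℕ.+-suc N m)) (s≤s (ℕ.m≤m+n N m))))
                       (cong (X C_) (trans (cong (_∸ suc N) (ℕ.+-suc N m)) (ℕ.m+n∸m≡n N m)))

  multichoose-convolution : ∀ m N i →
    sumBelow (suc N) (λ t → + ((N ∸ t) C i) * + multichoose m t) ≡ + ((N ℕ.+ m) C (i ℕ.+ m))
  multichoose-convolution m zero    zero    = sym (cong +_ (nCn≡1 m))
  multichoose-convolution m zero    (suc i) = sym (cong +_ (k>n⇒nCk≡0 (s≤s (ℕ.m≤n+m m i))))
  multichoose-convolution m (suc N) zero    = begin
    sumBelow (suc N) (λ t → + 1 * + multichoose m t) + + 1 * + multichoose m (suc N)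
      ≡⟨ cong₂ _+_ (multichoose-convolution m N 0) (ℤ.*-identityˡ _) ⟩
    + ((N ℕ.+ m) C m) + + multichoose m (suc N)
      ≡⟨ ℤ.pos-+ ((N ℕ.+ m) C m) _ ⟨
    + ((N ℕ.+ m) C m ℕ.+ multichoose m (suc N))
      ≡⟨ cong +_ (multichoose-hockeyStick m N) ⟩
    + ((suc N ℕ.+ m) C m)
      ∎
    where open ≡-Reasoning
  multichoose-convolution m (suc N) (suc i) = begin
    sumBelow (suc N) (λ t → + ((suc N ∸ t) C suc i) * M t) + + ((N ∸ N) C suc i) * M (suc N)
      ≡⟨ cong₂ _+_ (sumBelow-cong (suc N) pascal) (cong (λ k → + (k C suc i) * M (suc N)) (ℕ.n∸n≡0 N)) ⟩
    sumBelow (suc N) (λ t → term i t + term (suc i) t) + + 0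
      ≡⟨ trans (ℤ.+-identityʳ _) (sumBelow-+ (suc N) (term i) (term (suc i))) ⟩
    sumBelow (suc N) (term i) + sumBelow (suc N) (term (suc i))
      ≡⟨ cong₂ _+_ (multichoose-convolution m N i) (multichoose-convolution m N (suc i)) ⟩
    + ((N ℕ.+ m) C (i ℕ.+ m)) + + ((N ℕ.+ m) C suc (i ℕ.+ m))
      ≡⟨ ℤ.pos-+ ((N ℕ.+ m) C (i ℕ.+ m)) _ ⟨
    + ((N ℕ.+ m) C (i ℕ.+ m) ℕ.+ (N ℕ.+ m) C suc (i ℕ.+ m))
      ≡⟨ cong +_ (C-pascal (N ℕ.+ m) (i ℕ.+ m)) ⟨
    + (suc (N ℕ.+ m) C suc (i ℕ.+ m))
      ∎
    where
    open ≡-Reasoning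
    M : ℕ → ℤ
    M t = + multichoose m t
    term : ℕ → ℕ → ℤ
    term i t = + ((N ∸ t) C i) * M t
    pascal : ∀ t → t < suc N → + ((suc N ∸ t) C suc i) * M t ≡ term i t + term (suc i) t
    pascal t t<1+N = begin
      + ((suc N ∸ t) C suc i) * M t
        ≡⟨ cong (λ k → + (k C suc i) * M t) (ℕ.+-∸-assoc 1 (ℕ.s≤s⁻¹ t<1+N)) ⟩
      + (suc (N ∸ t) C suc i) * M t
        ≡⟨ cong (λ k → + k * M t) (C-pascal (N ∸ t) i) ⟩
      + ((N ∸ t) C i ℕ.+ (N ∸ t) C suc i) * M t
        ≡⟨ cong (_* M t) (ℤ.pos-+ ((N ∸ t) C i) _) ⟩
      (+ ((N ∸ t) C i) + + ((N ∸ t) C suc i)) * M t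
        ≡⟨ ℤ.*-distribʳ-+ (M t) (+ ((N ∸ t) C i)) (+ ((N ∸ t) C suc i)) ⟩
      term i t + term (suc i) t
        ∎

  mulX : Poly → Poly
  mulX P zero    = + 0
  mulX P (suc k) = P k

  private
    variable
      P P′ G G′ : Poly

  pmul≡sumBelow : ∀ P G i → pmul P G i ≡ sumBelow (suc i) (λ a → P a * G (i ∸ a))
  pmul≡sumBelow P G i = sumTo≡sumBelow i _

  pmul-congˡ : ∀ G i → (∀ k → P k ≡ P′ k) → pmul P G i ≡ pmul P′ G i
  pmul-congˡ {P} {P′} G i P≡P′ = begin
    pmul P G i
      ≡⟨ pmul≡sumBelow P G i ⟩
    sumBelow (suc i) (λ a → P a * G (i ∸ a))
      ≡⟨ sumBelow-cong (suc i) (λ a _ → cong (_* G (i ∸ a)) (P≡P′ a)) ⟩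
    sumBelow (suc i) (λ a → P′ a * G (i ∸ a))
      ≡⟨ pmul≡sumBelow P′ G i ⟨
    pmul P′ G i
      ∎
    where open ≡-Reasoning

  pmul-congʳ : ∀ P i → (∀ k → G k ≡ G′ k) → pmul P G i ≡ pmul P G′ i
  pmul-congʳ {G} {G′} P i G≡G′ = begin
    pmul P G i
      ≡⟨ pmul≡sumBelow P G i ⟩
    sumBelow (suc i) (λ a → P a * G (i ∸ a))
      ≡⟨ sumBelow-cong (suc i) (λ a _ → cong (P a *_) (G≡G′ (i ∸ a))) ⟩
    sumBelow (suc i) (λ a → P a * G′ (i ∸ a))
      ≡⟨ pmul≡sumBelow P G′ i ⟨
    pmul P G′ i
      ∎
    where open ≡-Reasoning

  pmul-+ˡ : ∀ P P′ G i → pmul (padd P P′) G i ≡ pmul P G i + pmul P′ G i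
  pmul-+ˡ P P′ G i = begin
    pmul (padd P P′) G i
      ≡⟨ pmul≡sumBelow (padd P P′) G i ⟩
    sumBelow (suc i) (λ a → (P a + P′ a) * G (i ∸ a))
      ≡⟨ sumBelow-cong (suc i) (λ a _ → ℤ.*-distribʳ-+ (G (i ∸ a)) (P a) (P′ a)) ⟩
    sumBelow (suc i) (λ a → P a * G (i ∸ a) + P′ a * G (i ∸ a))
      ≡⟨ sumBelow-+ (suc i) _ _ ⟩
    sumBelow (suc i) (λ a → P a * G (i ∸ a)) + sumBelow (suc i) (λ a → P′ a * G (i ∸ a))
      ≡⟨ cong₂ _+_ (pmul≡sumBelow P G i) (pmul≡sumBelow P′ G i) ⟨
    pmul P G i + pmul P′ G i
      ∎
    where open ≡-Reasoning

  pmul-+ʳ : ∀ P G H i → pmul P (padd G H) i ≡ pmul P G i + pmul P H i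
  pmul-+ʳ P G H i = begin
    pmul P (padd G H) i
      ≡⟨ pmul≡sumBelow P (padd G H) i ⟩
    sumBelow (suc i) (λ a → P a * (G (i ∸ a) + H (i ∸ a)))
      ≡⟨ sumBelow-cong (suc i) (λ a _ → ℤ.*-distribˡ-+ (P a) (G (i ∸ a)) (H (i ∸ a))) ⟩
    sumBelow (suc i) (λ a → P a * G (i ∸ a) + P a * H (i ∸ a))
      ≡⟨ sumBelow-+ (suc i) _ _ ⟩
    sumBelow (suc i) (λ a → P a * G (i ∸ a)) + sumBelow (suc i) (λ a → P a * H (i ∸ a))
      ≡⟨ cong₂ _+_ (pmul≡sumBelow P G i) (pmul≡sumBelow P H i) ⟨
    pmul P G i + pmul P H i
      ∎
    where open ≡-Reasoning

  pmul-scaleʳ : ∀ P c G i → pmul P (pscale c G) i ≡ c * pmul P G i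
  pmul-scaleʳ P c G i = begin
    pmul P (pscale c G) i
      ≡⟨ pmul≡sumBelow P (pscale c G) i ⟩
    sumBelow (suc i) (λ a → P a * (c * G (i ∸ a)))
      ≡⟨ sumBelow-cong (suc i) (λ a _ → swap (P a) c (G (i ∸ a))) ⟩
    sumBelow (suc i) (λ a → c * (P a * G (i ∸ a)))
      ≡⟨ sumBelow-*ˡ (suc i) c _ ⟩
    c * sumBelow (suc i) (λ a → P a * G (i ∸ a))
      ≡⟨ cong (c *_) (pmul≡sumBelow P G i) ⟨
    c * pmul P G i
      ∎
    where
    open ≡-Reasoning
    swap : ∀ p c g → p * (c * g) ≡ c * (p * g)
    swap = solve-∀

  pmul-sucˡ : ∀ P G i → pmul P G (suc i) ≡ P 0 * G (suc i) + pmul (λ a → P (suc a)) G i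
  pmul-sucˡ P G i = begin
    pmul P G (suc i)
      ≡⟨ pmul≡sumBelow P G (suc i) ⟩
    sumBelow (suc (suc i)) (λ a → P a * G (suc i ∸ a))
      ≡⟨ sumBelow-sucˡ (suc i) _ ⟩
    P 0 * G (suc i) + sumBelow (suc i) (λ a → P (suc a) * G (i ∸ a))
      ≡⟨ cong (λ x → P 0 * G (suc i) + x) (pmul≡sumBelow (λ a → P (suc a)) G i) ⟨
    P 0 * G (suc i) + pmul (λ a → P (suc a)) G i
      ∎
    where open ≡-Reasoning

  pmul-mulXʳ : ∀ P G i → pmul P (mulX G) (suc i) ≡ pmul P G i
  pmul-mulXʳ P G i = begin
    pmul P (mulX G) (suc i)
      ≡⟨ pmul≡sumBelow P (mulX G) (suc i) ⟩
    sumBelow (suc i) (λ a → P a * mulX G (suc i ∸ a)) + P (suc i) * mulX G (i ∸ i)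
      ≡⟨ cong₂ _+_ (sumBelow-cong (suc i) lower) top ⟩
    sumBelow (suc i) (λ a → P a * G (i ∸ a)) + + 0
      ≡⟨ ℤ.+-identityʳ _ ⟩
    sumBelow (suc i) (λ a → P a * G (i ∸ a))
      ≡⟨ pmul≡sumBelow P G i ⟨
    pmul P G i
      ∎
    where
    open ≡-Reasoning
    lower : ∀ a → a < suc i → P a * mulX G (suc i ∸ a) ≡ P a * G (i ∸ a)
    lower a a<1+i = cong (λ k → P a * mulX G k) (ℕ.+-∸-assoc 1 (ℕ.s≤s⁻¹ a<1+i))
    top : P (suc i) * mulX G (i ∸ i) ≡ + 0
    top = trans (cong (λ k → P (suc i) * mulX G k) (ℕ.n∸n≡0 i)) (ℤ.*-zeroʳ (P (suc i)))

  pmul-constantʳ : ∀ P G i → (∀ k → G (suc k) ≡ + 0) → pmul P G i ≡ P i * G 0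
  pmul-constantʳ P G i G≡0 = begin
    pmul P G i
      ≡⟨ pmul≡sumBelow P G i ⟩
    sumBelow i (λ a → P a * G (i ∸ a)) + P i * G (i ∸ i)
      ≡⟨ cong₂ _+_ (sumBelow-zero i lower) (cong (λ k → P i * G k) (ℕ.n∸n≡0 i)) ⟩
    + 0 + P i * G 0
      ≡⟨ ℤ.+-identityˡ _ ⟩
    P i * G 0
      ∎
    where
    open ≡-Reasoning
    lower : ∀ a → a < i → P a * G (i ∸ a) ≡ + 0
    lower a a<i =
      trans (cong (λ k → P a * G k) (ℕ.+-∸-assoc 1 a<i)) (trans (cong (P a *_) (G≡0 (i ∸ suc a))) (ℤ.*-zeroʳ (P a)))

  pmul-xPlus1Pow-suc : ∀ j F i → pmul (xPlus1Pow (suc j)) F i ≡ pmul (xPlus1Pow j) (padd F (mulX F)) i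
  pmul-xPlus1Pow-suc j F zero    = cong (+ 1 *_) (sym (ℤ.+-identityʳ (F 0)))
  pmul-xPlus1Pow-suc j F (suc i) = begin
    pmul (xPlus1Pow (suc j)) F (suc i)
      ≡⟨ pmul-sucˡ (xPlus1Pow (suc j)) F i ⟩
    + 1 * F (suc i) + pmul (λ a → xPlus1Pow (suc j) (suc a)) F i
      ≡⟨ cong (λ x → + 1 * F (suc i) + x) (pmul-congˡ F i pascal) ⟩
    + 1 * F (suc i) + pmul (padd (xPlus1Pow j) (λ a → xPlus1Pow j (suc a))) F i
      ≡⟨ cong (λ x → + 1 * F (suc i) + x) (pmul-+ˡ (xPlus1Pow j) (λ a → xPlus1Pow j (suc a)) F i) ⟩
    + 1 * F (suc i) + (pmul (xPlus1Pow j) F i + pmul (λ a → xPlus1Pow j (suc a)) F i)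
      ≡⟨ regroup (+ 1 * F (suc i)) (pmul (xPlus1Pow j) F i) _ ⟩
    (+ 1 * F (suc i) + pmul (λ a → xPlus1Pow j (suc a)) F i) + pmul (xPlus1Pow j) F i
      ≡⟨ cong₂ _+_ (pmul-sucˡ (xPlus1Pow j) F i) (pmul-mulXʳ (xPlus1Pow j) F i) ⟨
    pmul (xPlus1Pow j) F (suc i) + pmul (xPlus1Pow j) (mulX F) (suc i)
      ≡⟨ pmul-+ʳ (xPlus1Pow j) F (mulX F) (suc i) ⟨
    pmul (xPlus1Pow j) (padd F (mulX F)) (suc i)
      ∎
    where
    open ≡-Reasoning
    pascal : ∀ a → xPlus1Pow (suc j) (suc a) ≡ padd (xPlus1Pow j) (λ a → xPlus1Pow j (suc a)) a
    pascal a = trans (cong +_ (C-pascal j a)) (ℤ.pos-+ (j C a) _)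
    regroup : ∀ x y z → x + (y + z) ≡ (x + z) + y
    regroup = solve-∀

  module Modulo (p : ℕ) where

    infix 4 _≈_

    -- A record rather than a synonym for + p ∣ a - b, so that a and b can be inferred from a ≈ b.

    record _≈_ (a b : ℤ) : Set where
      constructor ∣⇒≈
      field ≈⇒∣ : + p ∣ a - b

    open _≈_ public

    private
      variable
        a b c d x : ℤ

      ∣-resp : ∀ {x y} → x ≡ y → + p ∣ x → + p ∣ y
      ∣-resp = subst (+ p ∣_)

    ≈-reflexive : a ≡ b → a ≈ b
    ≈-reflexive {a} refl = ∣⇒≈ (divides (+ 0) (ℤ.+-inverseʳ a))

    ≈-refl : a ≈ a
    ≈-refl = ≈-reflexive refl

    ≈-sym : a ≈ b → b ≈ a
    ≈-sym {a} {b} (∣⇒≈ p∣a-b) = ∣⇒≈ (∣-resp (negate a b) (∣m⇒∣-m p∣a-b))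
      where
      negate : ∀ a b → - (a - b) ≡ b - a
      negate = solve-∀

    ≈-trans : a ≈ b → b ≈ c → a ≈ c
    ≈-trans {a} {b} {c} (∣⇒≈ p∣a-b) (∣⇒≈ p∣b-c) =
      ∣⇒≈ (∣-resp (telescope a b c) (∣m∣n⇒∣m+n p∣a-b p∣b-c))
      where
      telescope : ∀ a b c → a - b + (b - c) ≡ a - c
      telescope = solve-∀

    ≈-isEquivalence : IsEquivalence _≈_
    ≈-isEquivalence = record { refl = ≈-refl ; sym = ≈-sym ; trans = ≈-trans }

    ≈-setoid : Setoid _ _
    ≈-setoid = record { isEquivalence = ≈-isEquivalence }

    module ≈-Reasoning = SetoidReasoning ≈-setoid

    +-cong : a ≈ b → c ≈ d → a + c ≈ b + d
    +-cong {a} {b} {c} {d} (∣⇒≈ p∣a-b) (∣⇒≈ p∣c-d) =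
      ∣⇒≈ (∣-resp (interchange a b c d) (∣m∣n⇒∣m+n p∣a-b p∣c-d))
      where
      interchange : ∀ a b c d → a - b + (c - d) ≡ a + c - (b + d)
      interchange = solve-∀

    *-congˡ : ∀ c → a ≈ b → c * a ≈ c * b
    *-congˡ {a} {b} c (∣⇒≈ p∣a-b) = ∣⇒≈ (∣-resp (distrib c a b) (∣n⇒∣m*n c p∣a-b))
      where
      distrib : ∀ c a b → c * (a - b) ≡ c * a - c * b
      distrib = solve-∀

    *-congʳ : ∀ c → a ≈ b → a * c ≈ b * c
    *-congʳ {a} {b} c a≈b = subst₂ _≈_ (ℤ.*-comm c a) (ℤ.*-comm c b) (*-congˡ c a≈b)

    *-cong : a ≈ b → c ≈ d → a * c ≈ b * d
    *-cong {b = b} {c = c} a≈b c≈d = ≈-trans (*-congʳ c a≈b) (*-congˡ b c≈d)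

    -‿cong : a ≈ b → - a ≈ - b
    -‿cong {a} {b} a≈b = subst₂ _≈_ (ℤ.-1*i≡-i a) (ℤ.-1*i≡-i b) (*-congˡ -1ℤ a≈b)

    ^-cong : ∀ n → a ≈ b → a ^ n ≈ b ^ n
    ^-cong zero    a≈b = ≈-refl
    ^-cong (suc n) a≈b = *-cong a≈b (^-cong n a≈b)

    sumBelow-cong≈ : ∀ n {f g : ℕ → ℤ} → (∀ k → k < n → f k ≈ g k) → sumBelow n f ≈ sumBelow n g
    sumBelow-cong≈ zero    f≈g = ≈-refl
    sumBelow-cong≈ (suc n) f≈g =
      +-cong (sumBelow-cong≈ n λ k k<n → f≈g k (ℕ.m<n⇒m<1+n k<n)) (f≈g n (ℕ.n<1+n n))

    ∣⇒≈0 : + p ∣ x → x ≈ + 0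
    ∣⇒≈0 {x} p∣x = ∣⇒≈ (∣-resp (sym (ℤ.+-identityʳ x)) p∣x)

    ≈0⇒∣ : x ≈ + 0 → + p ∣ x
    ≈0⇒∣ {x} (∣⇒≈ p∣x-0) = ∣-resp (ℤ.+-identityʳ x) p∣x-0

    a≈b⇒a-b≈0 : a ≈ b → a - b ≈ + 0
    a≈b⇒a-b≈0 (∣⇒≈ p∣a-b) = ∣⇒≈0 p∣a-b

    a-b≈0⇒a≈b : a - b ≈ + 0 → a ≈ b
    a-b≈0⇒a≈b a-b≈0 = ∣⇒≈ (≈0⇒∣ a-b≈0)

    p≈0 : + p ≈ + 0
    p≈0 = ∣⇒≈0 (divides (+ 1) (sym (ℤ.*-identityˡ (+ p))))

    ≈⇒∣ᵤ : a ≈ b → + p Unsigned.∣ a - b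
    ≈⇒∣ᵤ (∣⇒≈ p∣a-b) = ∣⇒∣ᵤ p∣a-b

    pmul-≈0ʳ : ∀ P G i → (∀ k → G k ≈ + 0) → pmul P G i ≈ + 0
    pmul-≈0ʳ P G i G≈0 = begin
      pmul P G i
        ≡⟨ pmul≡sumBelow P G i ⟩
      sumBelow (suc i) (λ a → P a * G (i ∸ a))
        ≈⟨ sumBelow-cong≈ (suc i) (λ a _ → *-congˡ (P a) (G≈0 (i ∸ a))) ⟩
      sumBelow (suc i) (λ a → P a * + 0)
        ≡⟨ sumBelow-zero (suc i) (λ a _ → ℤ.*-zeroʳ (P a)) ⟩
      + 0
        ∎
      where open ≈-Reasoning

  -1^n*-1^n≡1 : ∀ n → -1ℤ ^ n * -1ℤ ^ n ≡ + 1
  -1^n*-1^n≡1 zero    = refl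
  -1^n*-1^n≡1 (suc n) = trans (square (-1ℤ ^ n)) (-1^n*-1^n≡1 n)
    where
    square : ∀ s → (- + 1 * s) * (- + 1 * s) ≡ s * s
    square = solve-∀

  -- (-1)^N times the N-th forward difference of x ↦ x^j at a.
  differenceSum : ℕ → ℕ → ℤ → ℤ
  differenceSum N j a = sumBelow (suc N) (λ k → -1ℤ ^ k * + (N C k) * (+ k + a) ^ j)

  differenceSum-constant : ∀ N a → differenceSum (suc N) 0 a ≡ + 0
  differenceSum-constant N a = begin
    differenceSum (suc N) 0 a
      ≡⟨ sumBelow-cong (suc (suc N)) (λ k _ → swap (-1ℤ ^ k) (+ (suc N C k))) ⟩
    sumBelow (suc (suc N)) (λ k → + (suc N C k) * -1ℤ ^ k)
      ≡⟨ binomial (suc N) -1ℤ ⟨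
    (+ 1 + -1ℤ) ^ suc N
      ≡⟨⟩
    + 0
      ∎
    where
    open ≡-Reasoning
    swap : ∀ s c → s * c * + 1 ≡ c * s
    swap = solve-∀

  differenceSum-suc : ∀ N j a →
    differenceSum (suc N) (suc j) a ≡ a * differenceSum (suc N) j a - + suc N * differenceSum N j (a + + 1)
  differenceSum-suc N j a = begin
    differenceSum (suc N) (suc j) a
      ≡⟨ sumBelow-cong (suc (suc N)) (λ k _ → split (-1ℤ ^ k) (+ (suc N C k)) (+ k) a ((+ k + a) ^ j)) ⟩
    sumBelow (suc (suc N)) (λ k → a * t k + + k * t k)
      ≡⟨ sumBelow-+ (suc (suc N)) (λ k → a * t k) (λ k → + k * t k) ⟩
    sumBelow (suc (suc N)) (λ k → a * t k) + sumBelow (suc (suc N)) (λ k → + k * t k)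
      ≡⟨ cong₂ _+_ (sumBelow-*ˡ (suc (suc N)) a t) (sumBelow-sucˡ (suc N) (λ k → + k * t k)) ⟩
    a * differenceSum (suc N) j a + (+ 0 + sumBelow (suc N) (λ k → + suc k * t (suc k)))
      ≡⟨ cong (λ x → a * D + x) (trans (ℤ.+-identityˡ _) (sumBelow-cong (suc N) (λ k _ → absorbed k))) ⟩
    a * differenceSum (suc N) j a + sumBelow (suc N) (λ k → -1ℤ * (+ suc N * u k))
      ≡⟨ cong (λ x → a * D + x) (trans (sumBelow-*ˡ (suc N) -1ℤ _) (ℤ.-1*i≡-i _)) ⟩
    a * differenceSum (suc N) j a + - sumBelow (suc N) (λ k → + suc N * u k)
      ≡⟨ cong (λ x → a * D - x) (sumBelow-*ˡ (suc N) (+ suc N) u) ⟩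
    a * differenceSum (suc N) j a - + suc N * differenceSum N j (a + + 1)
      ∎
    where
    open ≡-Reasoning
    D = differenceSum (suc N) j a
    t : ℕ → ℤ
    t k = -1ℤ ^ k * + (suc N C k) * (+ k + a) ^ j
    u : ℕ → ℤ
    u k = -1ℤ ^ k * + (N C k) * (+ k + (a + + 1)) ^ j
    split : ∀ s c k a y → s * c * ((k + a) * y) ≡ a * (s * c * y) + k * (s * c * y)
    split = solve-∀
    shift : ∀ k a → + 1 + k + a ≡ k + (a + + 1)
    shift = solve-∀
    regroup : ∀ K s C Y → K * (- + 1 * s * C * Y) ≡ - + 1 * ((K * C) * (s * Y))
    regroup = solve-∀
    reassociate : ∀ M C s Y → M * C * (s * Y) ≡ M * (s * C * Y)
    reassociate = solve-∀
    absorbed : ∀ k → + suc k * t (suc k) ≡ -1ℤ * (+ suc N * u k)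
    absorbed k = begin
      + suc k * t (suc k)
        ≡⟨ cong (λ x → + suc k * (-1ℤ ^ suc k * + (suc N C suc k) * x ^ j)) (shift (+ k) a) ⟩
      + suc k * (-1ℤ ^ suc k * + (suc N C suc k) * (+ k + (a + + 1)) ^ j)
        ≡⟨ regroup (+ suc k) (-1ℤ ^ k) (+ (suc N C suc k)) _ ⟩
      -1ℤ * (+ suc k * + (suc N C suc k) * (-1ℤ ^ k * (+ k + (a + + 1)) ^ j))
        ≡⟨ cong (λ x → -1ℤ * (x * (-1ℤ ^ k * (+ k + (a + + 1)) ^ j))) absorb ⟩
      -1ℤ * (+ suc N * + (N C k) * (-1ℤ ^ k * (+ k + (a + + 1)) ^ j))
        ≡⟨ cong (-1ℤ *_) (reassociate (+ suc N) (+ (N C k)) (-1ℤ ^ k) _) ⟩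
      -1ℤ * (+ suc N * u k)
        ∎
      where
      absorb : + suc k * + (suc N C suc k) ≡ + suc N * + (N C k)
      absorb = trans (sym (ℤ.pos-* (suc k) _)) (trans (cong +_ (C-absorb N k)) (ℤ.pos-* (suc N) _))

  differenceSum-below : ∀ {j N} a → j < N → differenceSum N j a ≡ + 0
  differenceSum-below {zero}  {suc N} a _           = differenceSum-constant N a
  differenceSum-below {suc j} {suc N} a (s≤s j<N) = begin
    differenceSum (suc N) (suc j) a
      ≡⟨ differenceSum-suc N j a ⟩
    a * differenceSum (suc N) j a - + suc N * differenceSum N j (a + + 1)
      ≡⟨ cong₂ (λ x y → a * x - + suc N * y)
               (differenceSum-below a (ℕ.m<n⇒m<1+n j<N)) (differenceSum-below (a + + 1) j<N) ⟩
    a * + 0 - + suc N * + 0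
      ≡⟨ vanish a (+ suc N) ⟩
    + 0
      ∎
    where
    open ≡-Reasoning
    vanish : ∀ a n → a * + 0 - n * + 0 ≡ + 0
    vanish = solve-∀

  differenceSum-diagonal : ∀ N a → differenceSum N N a ≡ -1ℤ ^ N * + (N !)
  differenceSum-diagonal zero    a = refl
  differenceSum-diagonal (suc N) a = begin
    differenceSum (suc N) (suc N) a
      ≡⟨ differenceSum-suc N N a ⟩
    a * differenceSum (suc N) N a - + suc N * differenceSum N N (a + + 1)
      ≡⟨ cong₂ (λ x y → a * x - + suc N * y)
               (differenceSum-below a (ℕ.n<1+n N)) (differenceSum-diagonal N (a + + 1)) ⟩
    a * + 0 - + suc N * (-1ℤ ^ N * + (N !))
      ≡⟨ regroup a (+ suc N) (-1ℤ ^ N) (+ (N !)) ⟩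
    - + 1 * -1ℤ ^ N * (+ suc N * + (N !))
      ≡⟨ cong (- + 1 * -1ℤ ^ N *_) (ℤ.pos-* (suc N) (N !)) ⟨
    -1ℤ ^ suc N * + (suc N !)
      ∎
    where
    open ≡-Reasoning
    regroup : ∀ a n s f → a * + 0 - n * (s * f) ≡ - + 1 * s * (n * f)
    regroup = solve-∀

  factorial*multichoose-suc : ∀ m t →
    suc t ! ℕ.* multichoose m (suc t) ≡ t ! ℕ.* multichoose m t ℕ.* (t ℕ.+ m)
  factorial*multichoose-suc m t = begin
    suc t ! ℕ.* multichoose m (suc t)
      ≡⟨ shuffle (suc t) (t !) (multichoose m (suc t)) ⟩
    t ! ℕ.* (suc t ℕ.* multichoose m (suc t))
      ≡⟨ cong (t ! ℕ.*_) (multichoose-absorb m t) ⟩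
    t ! ℕ.* ((t ℕ.+ m) ℕ.* multichoose m t)
      ≡⟨ shuffle′ (t !) (t ℕ.+ m) (multichoose m t) ⟩
    t ! ℕ.* multichoose m t ℕ.* (t ℕ.+ m)
      ∎
    where
    open ≡-Reasoning
    shuffle : ∀ a b c → a ℕ.* b ℕ.* c ≡ b ℕ.* (a ℕ.* c)
    shuffle = ℕ-solve-∀
    shuffle′ : ∀ a b c → a ℕ.* (b ℕ.* c) ≡ a ℕ.* c ℕ.* b
    shuffle′ = ℕ-solve-∀

  fall-neg : ∀ m t → fall (- + m) t ≡ -1ℤ ^ t * + (t ! ℕ.* multichoose m t)
  fall-neg m zero    = refl
  fall-neg m (suc t) = begin
    fall (- + m) t * (- + m - + t)
      ≡⟨ cong (_* (- + m - + t)) (fall-neg m t) ⟩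
    -1ℤ ^ t * + X * (- + m - + t)
      ≡⟨ regroup (-1ℤ ^ t) (+ X) (+ m) (+ t) ⟩
    - + 1 * -1ℤ ^ t * (+ X * (+ t + + m))
      ≡⟨ cong (λ y → - + 1 * -1ℤ ^ t * y) (ℤ.pos-* X (t ℕ.+ m)) ⟨
    -1ℤ ^ suc t * + (X ℕ.* (t ℕ.+ m))
      ≡⟨ cong (λ y → -1ℤ ^ suc t * + y) (factorial*multichoose-suc m t) ⟨
    -1ℤ ^ suc t * + (suc t ! ℕ.* multichoose m (suc t))
      ∎
    where
    open ≡-Reasoning
    X = t ! ℕ.* multichoose m t
    regroup : ∀ s x m t → s * x * (- m - t) ≡ - + 1 * s * (x * (t + m))
    regroup = solve-∀

  -- Parametrised by p-1 so that p ∸ 1 computes to p-1.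
  module PrimeModulus (p-1 : ℕ) (p-prime : Prime (suc p-1)) where

    p : ℕ
    p = suc p-1

    open Modulo p public

    0<p-1 : 0 < p-1
    0<p-1 = ℕ.s<s⁻¹ (ℕ.nonTrivial⇒n>1 p {{prime⇒nonTrivial p-prime}})

    cancelˡ : ∀ {k x} → 0 < k → k < p → + k * x ≈ + 0 → x ≈ + 0
    cancelˡ {k} {x} 0<k k<p kx≈0 with euclidsLemma k (ℤ.∣ x ∣) p-prime p∣k∣x∣
      where
      p∣k∣x∣ : p ℕ.∣ k ℕ.* ℤ.∣ x ∣
      p∣k∣x∣ = subst (p ℕ.∣_) (ℤ.abs-* (+ k) x) (∣⇒∣ᵤ (≈0⇒∣ kx≈0))
    ... | inj₁ p∣k  = contradiction (ℕ.∣⇒≤ {{ℕ.>-nonZero 0<k}} p∣k) (ℕ.<⇒≱ k<p)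
    ... | inj₂ p∣∣x∣ = ∣⇒≈0 (∣ᵤ⇒∣ p∣∣x∣)

    C[p,k]≈0 : ∀ {k} → 0 < k → k < p → + (p C k) ≈ + 0
    C[p,k]≈0 {suc k} 0<k k<p = cancelˡ 0<k k<p (begin
      + suc k * + (p C suc k)        ≡⟨ ℤ.pos-* (suc k) (p C suc k) ⟨
      + (suc k ℕ.* (p C suc k))      ≡⟨ cong +_ (C-absorb p-1 k) ⟩
      + (p ℕ.* (p-1 C k))            ≈⟨ ∣⇒≈0 (∣ᵤ⇒∣ (ℕ.m∣m*n (p-1 C k))) ⟩
      + 0                            ∎)
      where open ≈-Reasoning

    fermat : ∀ k → (+ k) ^ p ≈ + k
    fermat zero    = ≈-refl
    fermat (suc k) = begin
      (+ 1 + + k) ^ p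
        ≡⟨ binomial p (+ k) ⟩
      sumBelow (suc p) f
        ≡⟨ sumBelow-sucˡ p f ⟩
      + 1 + (sumBelow p-1 (λ i → f (suc i)) + f p)
        ≈⟨ +-cong (≈-refl {+ 1}) (+-cong middle top) ⟩
      + 1 + (+ 0 + + k)
        ≡⟨⟩
      + suc k
        ∎
      where
      open ≈-Reasoning
      f : ℕ → ℤ
      f i = + (p C i) * (+ k) ^ i
      middle : sumBelow p-1 (λ i → f (suc i)) ≈ + 0
      middle = ≈-trans
        (sumBelow-cong≈ p-1 λ i i<p-1 → *-congʳ ((+ k) ^ suc i) (C[p,k]≈0 (s≤s z≤n) (s≤s i<p-1)))
        (≈-reflexive (sumBelow-zero p-1 λ _ _ → refl))
      top : f p ≈ + k
      top = ≈-trans (≈-reflexive (trans (cong (λ c → + c * (+ k) ^ p) (nCn≡1 p)) (ℤ.*-identityˡ _)))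
                    (fermat k)

    fermat-unit : ∀ {k} → 0 < k → k < p → (+ k) ^ p-1 ≈ + 1
    fermat-unit {k} 0<k k<p = a-b≈0⇒a≈b (cancelˡ 0<k k<p (begin
      + k * ((+ k) ^ p-1 - + 1)     ≡⟨ expand (+ k) ((+ k) ^ p-1) ⟩
      (+ k) ^ p - + k               ≈⟨ a≈b⇒a-b≈0 (fermat k) ⟩
      + 0                         ∎))
      where
      open ≈-Reasoning
      expand : ∀ k x → k * (x - + 1) ≡ k * x - k
      expand = solve-∀

    C[p-1,k]≈sign : ∀ {k} → k < p → + (p-1 C k) ≈ -1ℤ ^ k
    C[p-1,k]≈sign {zero}  _   = ≈-refl
    C[p-1,k]≈sign {suc k} k<p = begin
      + (p-1 C suc k)
        ≡⟨ pascal ⟩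
      + (p C suc k) - + (p-1 C k)
        ≈⟨ +-cong (C[p,k]≈0 (s≤s z≤n) k<p) (-‿cong (C[p-1,k]≈sign (ℕ.<-trans (ℕ.n<1+n k) k<p))) ⟩
      + 0 - -1ℤ ^ k
        ≡⟨ negate (-1ℤ ^ k) ⟩
      -1ℤ ^ suc k
        ∎
      where
      open ≈-Reasoning
      difference : ∀ a b → b ≡ a + b - a
      difference = solve-∀
      negate : ∀ s → + 0 - s ≡ - + 1 * s
      negate = solve-∀
      pascal : + (p-1 C suc k) ≡ + (p C suc k) - + (p-1 C k)
      pascal = trans (difference (+ (p-1 C k)) _)
                     (cong (_- + (p-1 C k)) (trans (sym (ℤ.pos-+ (p-1 C k) _)) (cong +_ (sym (C-pascal p-1 k)))))

    p-1≈-1 : + p-1 ≈ -1ℤ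
    p-1≈-1 = ∣⇒≈ (divides (+ 1) (shift (+ p-1)))
      where
      shift : ∀ x → x - - + 1 ≡ + 1 * (+ 1 + x)
      shift = solve-∀

    -- By Fermat, every term of differenceSum p-1 p-1 0 with k ≥ 1 is (-1)^k (-1)^k · 1 = 1.
    wilson : + (p-1 !) ≈ -1ℤ
    wilson = begin
      + (p-1 !)
        ≡⟨ ℤ.*-identityˡ _ ⟨
      + 1 * + (p-1 !)
        ≈⟨ *-congʳ (+ (p-1 !)) (≈-sym sign≈1) ⟩
      -1ℤ ^ p-1 * + (p-1 !)
        ≡⟨ differenceSum-diagonal p-1 (+ 0) ⟨
      differenceSum p-1 p-1 (+ 0)
        ≈⟨ sumBelow-cong≈ p term ⟩
      sumBelow p nonzero
        ≡⟨ trans (sumBelow-sucˡ p-1 nonzero) (trans (ℤ.+-identityˡ _) (sumBelow-const p-1 (+ 1))) ⟩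
      + p-1 * + 1
        ≡⟨ ℤ.*-identityʳ _ ⟩
      + p-1
        ≈⟨ p-1≈-1 ⟩
      -1ℤ
        ∎
      where
      open ≈-Reasoning
      sign≈1 : -1ℤ ^ p-1 ≈ + 1
      sign≈1 = ≈-trans (^-cong p-1 (≈-sym p-1≈-1)) (fermat-unit 0<p-1 (ℕ.n<1+n p-1))
      nonzero : ℕ → ℤ
      nonzero zero    = + 0
      nonzero (suc k) = + 1
      0^n≡0 : ∀ {n} → 0 < n → (+ 0) ^ n ≡ + 0
      0^n≡0 {suc n} _ = refl
      term : ∀ k → k < p → -1ℤ ^ k * + (p-1 C k) * (+ k + + 0) ^ p-1 ≈ nonzero k
      term zero    _   = ≈-reflexive (trans (cong (+ 1 *_) (0^n≡0 0<p-1)) (ℤ.*-zeroʳ (+ 1)))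
      term (suc k) k<p = begin
        -1ℤ ^ suc k * + (p-1 C suc k) * (+ suc k + + 0) ^ p-1
          ≈⟨ *-cong (*-congˡ (-1ℤ ^ suc k) (C[p-1,k]≈sign k<p)) unit ⟩
        -1ℤ ^ suc k * -1ℤ ^ suc k * + 1
          ≡⟨ trans (ℤ.*-identityʳ _) (-1^n*-1^n≡1 (suc k)) ⟩
        + 1
          ∎
        where
        unit : (+ suc k + + 0) ^ p-1 ≈ + 1
        unit = ≈-trans (≈-reflexive (cong (_^ p-1) (ℤ.+-identityʳ (+ suc k)))) (fermat-unit (s≤s z≤n) k<p)

    sign*factorials≈-1 : ∀ {t} → t ≤ p-1 → -1ℤ ^ t * + (t ! ℕ.* (p-1 ∸ t) !) ≈ -1ℤ
    sign*factorials≈-1 {t} t≤p-1 = begin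
      -1ℤ ^ t * + (t ! ℕ.* (p-1 ∸ t) !)      ≈⟨ *-congʳ _ (≈-sym (C[p-1,k]≈sign (s≤s t≤p-1))) ⟩
      + (p-1 C t) * + (t ! ℕ.* (p-1 ∸ t) !)  ≡⟨ ℤ.pos-* (p-1 C t) _ ⟨
      + ((p-1 C t) ℕ.* (t ! ℕ.* (p-1 ∸ t) !)) ≡⟨ cong +_ (C*factorials≡factorial t≤p-1) ⟩
      + (p-1 !)                              ≈⟨ wilson ⟩
      -1ℤ                                    ∎
      where open ≈-Reasoning

    p∣p! : p ℕ.∣ p !
    p∣p! = ℕ.m∣m*n (p-1 !)

    fall-neg[p]≈0 : ∀ m → fall (- + m) p ≈ + 0
    fall-neg[p]≈0 m = begin
      fall (- + m) p
        ≡⟨ fall-neg m p ⟩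
      -1ℤ ^ p * + (p ! ℕ.* multichoose m p)
        ≈⟨ *-congˡ (-1ℤ ^ p) (∣⇒≈0 (∣ᵤ⇒∣ (ℕ.∣m⇒∣m*n (multichoose m p) p∣p!))) ⟩
      -1ℤ ^ p * + 0
        ≡⟨ ℤ.*-zeroʳ (-1ℤ ^ p) ⟩
      + 0
        ∎
      where open ≈-Reasoning

    fall-neg*factorial≈-multichoose : ∀ m {t} → t ≤ p-1 →
      fall (- + m) t * + ((p-1 ∸ t) !) ≈ - + multichoose m t
    fall-neg*factorial≈-multichoose m {t} t≤p-1 = begin
      fall (- + m) t * + ((p-1 ∸ t) !)
        ≡⟨ cong (_* + ((p-1 ∸ t) !)) (fall-neg m t) ⟩
      -1ℤ ^ t * + (t ! ℕ.* M) * + ((p-1 ∸ t) !)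
        ≡⟨ regroup ⟩
      -1ℤ ^ t * + (t ! ℕ.* (p-1 ∸ t) !) * + M
        ≈⟨ *-congʳ (+ M) (sign*factorials≈-1 t≤p-1) ⟩
      -1ℤ * + M
        ≡⟨ ℤ.-1*i≡-i (+ M) ⟩
      - + M
        ∎
      where
      open ≈-Reasoning
      M = multichoose m t
      shuffle : ∀ s a m b → s * (a * m) * b ≡ s * (a * b) * m
      shuffle = solve-∀
      regroup : -1ℤ ^ t * + (t ! ℕ.* M) * + ((p-1 ∸ t) !) ≡ -1ℤ ^ t * + (t ! ℕ.* (p-1 ∸ t) !) * + M
      regroup = trans (cong (λ x → -1ℤ ^ t * x * + ((p-1 ∸ t) !)) (ℤ.pos-* (t !) M))
               (trans (shuffle (-1ℤ ^ t) (+ (t !)) (+ M) (+ ((p-1 ∸ t) !)))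
                      (cong (λ x → -1ℤ ^ t * x * + M) (sym (ℤ.pos-* (t !) ((p-1 ∸ t) !)))))

  if-true : ∀ {A : Set} {b} {x y : A} → b ≡ true → (if b then x else y) ≡ x
  if-true refl = refl

  if-false : ∀ {A : Set} {b} {x y : A} → b ≡ false → (if b then x else y) ≡ y
  if-false refl = refl

  ≡ᵇ-refl : ∀ n → (n ≡ᵇ n) ≡ true
  ≡ᵇ-refl zero    = refl
  ≡ᵇ-refl (suc n) = ≡ᵇ-refl n

  ≡ᵇ-false : ∀ {m n} → m ≢ n → (m ≡ᵇ n) ≡ false
  ≡ᵇ-false {m} {n} m≢n with m ≡ᵇ n | ℕ.≡ᵇ⇒≡ m n
  ... | false | _     = refl
  ... | true  | m≡n = contradiction (m≡n _) m≢n

  ≤ᵇ-true : ∀ {m n} → m ≤ n → (m ≤ᵇ n) ≡ true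
  ≤ᵇ-true {m} {n} m≤n with m ≤ᵇ n | ℕ.≤⇒≤ᵇ m≤n
  ... | true | _ = refl

  ≤ᵇ-false : ∀ {m n} → n < m → (m ≤ᵇ n) ≡ false
  ≤ᵇ-false {m} {n} n<m with m ≤ᵇ n | ℕ.≤ᵇ⇒≤ m n
  ... | false | _   = refl
  ... | true  | m≤n = contradiction (m≤n _) (ℕ.<⇒≱ n<m)

  rStirling2-initial : ∀ r K → rStirling2 r r K ≡ (if K ≡ᵇ r then 1 else 0)
  rStirling2-initial zero    K = refl
  rStirling2-initial (suc r) K = trans (if-true (≤ᵇ-true (ℕ.≤-refl {suc r})))
                                       (cong (λ b → if b ∧ (K ≡ᵇ suc r) then 1 else 0) (≡ᵇ-refl r))

  rStirling2-diagonal : ∀ r → rStirling2 r r r ≡ 1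
  rStirling2-diagonal r = trans (rStirling2-initial r r) (if-true (≡ᵇ-refl r))

  rStirling2-suc-zero : ∀ r n → rStirling2 r (suc n ℕ.+ r) 0 ≡ 0
  rStirling2-suc-zero r n = if-false (≤ᵇ-false (s≤s (ℕ.m≤n+m r n)))

  rStirling2-suc : ∀ r n K →
    rStirling2 r (suc n ℕ.+ r) (suc K)
      ≡ suc K ℕ.* rStirling2 r (n ℕ.+ r) (suc K) ℕ.+ rStirling2 r (n ℕ.+ r) K
  rStirling2-suc r n K = if-false (≤ᵇ-false (s≤s (ℕ.m≤n+m r n)))

  rStirling2-below : ∀ r n {K} → K < r → rStirling2 r (n ℕ.+ r) K ≡ 0
  rStirling2-below r zero    {K}     K<r = trans (rStirling2-initial r K) (if-false (≡ᵇ-false (ℕ.<⇒≢ K<r)))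
  rStirling2-below r (suc n) {zero}  K<r = rStirling2-suc-zero r n
  rStirling2-below r (suc n) {suc K} K<r = begin
    rStirling2 r (suc n ℕ.+ r) (suc K)
      ≡⟨ rStirling2-suc r n K ⟩
    suc K ℕ.* rStirling2 r (n ℕ.+ r) (suc K) ℕ.+ rStirling2 r (n ℕ.+ r) K
      ≡⟨ cong₂ (λ x y → suc K ℕ.* x ℕ.+ y)
               (rStirling2-below r n K<r) (rStirling2-below r n (ℕ.<-trans (ℕ.n<1+n K) K<r)) ⟩
    suc K ℕ.* 0 ℕ.+ 0
      ≡⟨ trans (ℕ.+-identityʳ _) (ℕ.*-zeroʳ (suc K)) ⟩
    0
      ∎
    where open ≡-Reasoning

  rStirling2-above : ∀ r {n k} → n < k → rStirling2 r (n ℕ.+ r) (k ℕ.+ r) ≡ 0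
  rStirling2-above r {zero}  {suc k} _         =
    trans (rStirling2-initial r (suc k ℕ.+ r)) (if-false (≡ᵇ-false (ℕ.m≢1+n+m r ∘′ sym)))
  rStirling2-above r {suc n} {suc k} (s≤s n<k) = begin
    rStirling2 r (suc n ℕ.+ r) (suc k ℕ.+ r)
      ≡⟨ rStirling2-suc r n (k ℕ.+ r) ⟩
    suc (k ℕ.+ r) ℕ.* rStirling2 r (n ℕ.+ r) (suc k ℕ.+ r) ℕ.+ rStirling2 r (n ℕ.+ r) (k ℕ.+ r)
      ≡⟨ cong₂ (λ x y → suc (k ℕ.+ r) ℕ.* x ℕ.+ y)
               (rStirling2-above r (ℕ.m<n⇒m<1+n n<k)) (rStirling2-above r n<k) ⟩
    suc (k ℕ.+ r) ℕ.* 0 ℕ.+ 0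
      ≡⟨ trans (ℕ.+-identityʳ _) (ℕ.*-zeroʳ (suc (k ℕ.+ r))) ⟩
    0
      ∎
    where open ≡-Reasoning

  rStirling2-suc-lowest : ∀ r n → rStirling2 r (suc n ℕ.+ r) r ≡ r ℕ.* rStirling2 r (n ℕ.+ r) r
  rStirling2-suc-lowest zero    n = rStirling2-suc-zero 0 n
  rStirling2-suc-lowest (suc r) n = begin
    rStirling2 (suc r) (suc n ℕ.+ suc r) (suc r)          ≡⟨ rStirling2-suc (suc r) n r ⟩
    suc r ℕ.* S ℕ.+ rStirling2 (suc r) (n ℕ.+ suc r) r   ≡⟨ cong (suc r ℕ.* S ℕ.+_) below ⟩
    suc r ℕ.* S ℕ.+ 0                                      ≡⟨ ℕ.+-identityʳ _ ⟩
    suc r ℕ.* S                                            ∎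
    where
    open ≡-Reasoning
    S = rStirling2 (suc r) (n ℕ.+ suc r) (suc r)
    below = rStirling2-below (suc r) n (ℕ.n<1+n r)

  fubini-coefficient : ∀ n r s k → fubini n r s k ≡ + rStirling2 r (n ℕ.+ r) (k ℕ.+ r) * + ((k ℕ.+ s) !)
  fubini-coefficient n r s k with k ℕ.≤? n
  ... | yes k≤n = trans (if-true (≤ᵇ-true k≤n)) (ℤ.pos-* (rStirling2 r (n ℕ.+ r) (k ℕ.+ r)) ((k ℕ.+ s) !))
  ... | no  k≰n = trans (if-false (≤ᵇ-false (ℕ.≰⇒> k≰n)))
                        (cong (λ S → + S * + ((k ℕ.+ s) !)) (sym (rStirling2-above r (ℕ.≰⇒> k≰n))))

  fubini-initial : ∀ r s → fubini 0 r s 0 ≡ + (s !)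
  fubini-initial r s = begin
    fubini 0 r s 0                      ≡⟨ fubini-coefficient 0 r s 0 ⟩
    + rStirling2 r r r * + (s !)        ≡⟨ cong (λ S → + S * + (s !)) (rStirling2-diagonal r) ⟩
    + 1 * + (s !)                       ≡⟨ ℤ.*-identityˡ (+ (s !)) ⟩
    + (s !)                             ∎
    where open ≡-Reasoning

  +suc!≡ : ∀ x → + (suc x !) ≡ (+ 1 + + x) * + (x !)
  +suc!≡ x = ℤ.pos-* (suc x) (x !)

  fubini-suc : ∀ n r s k →
    fubini (suc n) r s k
      ≡ padd (padd (fubini n r (suc s)) (mulX (fubini n r (suc s)))) (pscale (+ r - + s - + 1) (fubini n r s)) k
  fubini-suc n r s zero = begin
    fubini (suc n) r s 0
      ≡⟨ fubini-coefficient (suc n) r s 0 ⟩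
    + rStirling2 r (suc n ℕ.+ r) r * + (s !)
      ≡⟨ cong (λ S → + S * + (s !)) (rStirling2-suc-lowest r n) ⟩
    + (r ℕ.* A) * + (s !)
      ≡⟨ cong (_* + (s !)) (ℤ.pos-* r A) ⟩
    + r * + A * + (s !)
      ≡⟨ identity (+ r) (+ s) (+ A) (+ (s !)) ⟩
    + A * ((+ 1 + + s) * + (s !)) + + 0 + c * (+ A * + (s !))
      ≡⟨ cong₂ (λ x y → x + + 0 + c * y) lhs rhs ⟨
    fubini n r (suc s) 0 + + 0 + c * fubini n r s 0
      ∎
    where
    open ≡-Reasoning
    A = rStirling2 r (n ℕ.+ r) r
    c = + r - + s - + 1
    identity : ∀ r s A F → r * A * F ≡ A * ((+ 1 + s) * F) + + 0 + (r - s - + 1) * (A * F)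
    identity = solve-∀
    lhs : fubini n r (suc s) 0 ≡ + A * ((+ 1 + + s) * + (s !))
    lhs = trans (fubini-coefficient n r (suc s) 0) (cong (+ A *_) (+suc!≡ s))
    rhs : fubini n r s 0 ≡ + A * + (s !)
    rhs = fubini-coefficient n r s 0
  fubini-suc n r s (suc k) = begin
    fubini (suc n) r s (suc k)
      ≡⟨ fubini-coefficient (suc n) r s (suc k) ⟩
    + rStirling2 r (suc n ℕ.+ r) (suc k ℕ.+ r) * Φ
      ≡⟨ cong (_* Φ) stirling ⟩
    ((+ 1 + (U + + r - + s)) * + A + + B) * Φ
      ≡⟨ identity U (+ r) (+ s) (+ A) (+ B) Φ ⟩
    + A * ((+ 1 + (+ 1 + U)) * Φ) + + B * Φ + c * (+ A * Φ)
      ≡⟨ cong₂ _+_ (cong₂ _+_ shifted₁ shifted₂) (cong (c *_) (fubini-coefficient n r s (suc k))) ⟨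
    fubini n r (suc s) (suc k) + fubini n r (suc s) k + c * fubini n r s (suc k)
      ∎
    where
    open ≡-Reasoning
    A = rStirling2 r (n ℕ.+ r) (suc k ℕ.+ r)
    B = rStirling2 r (n ℕ.+ r) (k ℕ.+ r)
    U = + (k ℕ.+ s)
    Φ = + (suc (k ℕ.+ s) !)
    c = + r - + s - + 1
    identity : ∀ U r s A B F →
      ((+ 1 + (U + r - s)) * A + B) * F ≡ A * ((+ 1 + (+ 1 + U)) * F) + B * F + (r - s - + 1) * (A * F)
    identity = solve-∀
    exchange : ∀ k r s → k + r ≡ k + s + r - s
    exchange = solve-∀
    stirling : + rStirling2 r (suc n ℕ.+ r) (suc k ℕ.+ r) ≡ (+ 1 + (U + + r - + s)) * + A + + B
    stirling = begin
      + rStirling2 r (suc n ℕ.+ r) (suc k ℕ.+ r)   ≡⟨ cong +_ (rStirling2-suc r n (k ℕ.+ r)) ⟩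
      + (suc (k ℕ.+ r) ℕ.* A ℕ.+ B)      ≡⟨ ℤ.pos-+ (suc (k ℕ.+ r) ℕ.* A) B ⟩
      + (suc (k ℕ.+ r) ℕ.* A) + + B      ≡⟨ cong (_+ + B) (ℤ.pos-* (suc (k ℕ.+ r)) A) ⟩
      (+ 1 + + (k ℕ.+ r)) * + A + + B    ≡⟨ cong (λ x → (+ 1 + x) * + A + + B) (ℤ.pos-+ k r) ⟩
      (+ 1 + (+ k + + r)) * + A + + B    ≡⟨ cong (λ x → (+ 1 + x) * + A + + B) (exchange (+ k) (+ r) (+ s)) ⟩
      (+ 1 + (+ k + + s + + r - + s)) * + A + + B
        ≡⟨ cong (λ x → (+ 1 + (x + + r - + s)) * + A + + B) (ℤ.pos-+ k s) ⟨
      (+ 1 + (U + + r - + s)) * + A + + B ∎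
    [k+1+s]!≡Φ : + ((k ℕ.+ suc s) !) ≡ Φ
    [k+1+s]!≡Φ = cong (λ x → + (x !)) (ℕ.+-suc k s)
    shifted₁ : fubini n r (suc s) (suc k) ≡ + A * ((+ 1 + (+ 1 + U)) * Φ)
    shifted₁ = trans (fubini-coefficient n r (suc s) (suc k))
                     (cong (+ A *_) (trans (+suc!≡ (k ℕ.+ suc s))
                                           (cong₂ (λ x y → (+ 1 + x) * y) (cong +_ (ℕ.+-suc k s)) [k+1+s]!≡Φ)))
    shifted₂ : fubini n r (suc s) k ≡ + B * Φ
    shifted₂ = trans (fubini-coefficient n r (suc s) k) (cong (+ B *_) [k+1+s]!≡Φ)

  Tpoly-coefficient : ∀ n r j → Tpoly n r j ≡ + ((n ℕ.+ r) C (j ℕ.+ r))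
  Tpoly-coefficient n r j with j ℕ.≤? n
  ... | yes j≤n = if-true (≤ᵇ-true j≤n)
  ... | no  j≰n = trans (if-false (≤ᵇ-false (ℕ.≰⇒> j≰n)))
                        (cong +_ (sym (k>n⇒nCk≡0 (ℕ.+-monoˡ-< r (ℕ.≰⇒> j≰n)))))

  module FubiniCongruence (p-1 : ℕ) (p-prime : Prime (suc p-1)) (m r : ℕ) where
    open PrimeModulus p-1 p-prime

    a : ℕ → ℤ
    a j = fall (- + m) (p-1 ∸ j)

    -- b extends a to the left: b (suc j) = a j, and b 0 = (-m)_p ≡ 0.
    b : ℕ → ℤ
    b j = fall (- + m) (p ∸ j)

    c : ℕ → ℤ
    c j = + (r ℕ.+ m) - + j - + 1

    Q : ℕ → ℕ → Poly
    Q n j = pmul (xPlus1Pow j) (fubini n (r ℕ.+ m) j)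

    L : ℕ → Poly
    L n i = sumBelow p (λ j → a j * Q n j i)

    Q-suc : ∀ n j i → Q (suc n) j i ≡ Q n (suc j) i + c j * Q n j i
    Q-suc n j i = begin
      pmul (xPlus1Pow j) (fubini (suc n) (r ℕ.+ m) j) i
        ≡⟨ pmul-congʳ (xPlus1Pow j) i (fubini-suc n (r ℕ.+ m) j) ⟩
      pmul (xPlus1Pow j) (padd (padd F′ (mulX F′)) (pscale (c j) F)) i
        ≡⟨ pmul-+ʳ (xPlus1Pow j) (padd F′ (mulX F′)) (pscale (c j) F) i ⟩
      pmul (xPlus1Pow j) (padd F′ (mulX F′)) i + pmul (xPlus1Pow j) (pscale (c j) F) i
        ≡⟨ cong₂ _+_ (sym (pmul-xPlus1Pow-suc j F′ i)) (pmul-scaleʳ (xPlus1Pow j) (c j) F i) ⟩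
      Q n (suc j) i + c j * Q n j i
        ∎
      where
      open ≡-Reasoning
      F′ = fubini n (r ℕ.+ m) (suc j)
      F = fubini n (r ℕ.+ m) j

    fubini[p]≈0 : ∀ n s k → fubini n s p k ≈ + 0
    fubini[p]≈0 n s k = begin
      fubini n s p k
        ≡⟨ fubini-coefficient n s p k ⟩
      S * + ((k ℕ.+ p) !)
        ≈⟨ *-congˡ S (∣⇒≈0 (∣ᵤ⇒∣ (ℕ.∣-trans p∣p! (ℕ.m≤n⇒m!∣n! (ℕ.m≤n+m p k))))) ⟩
      S * + 0
        ≡⟨ ℤ.*-zeroʳ S ⟩
      + 0
        ∎
      where
      open ≈-Reasoning
      S = + rStirling2 s (n ℕ.+ s) (k ℕ.+ s)

    Q[p]≈0 : ∀ n i → Q n p i ≈ + 0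
    Q[p]≈0 n i = pmul-≈0ʳ (xPlus1Pow p) (fubini n (r ℕ.+ m) p) i (fubini[p]≈0 n (r ℕ.+ m))

    b+ac≈ra : ∀ {j} → j < p → b j + a j * c j ≈ + r * a j
    b+ac≈ra {j} j<p = begin
      b j + a j * c j
        ≡⟨ cong (λ x → fall (- + m) x + a j * c j) (ℕ.+-∸-assoc 1 j≤p-1) ⟩
      a j * (- + m - + d) + a j * (+ (r ℕ.+ m) - + j - + 1)
        ≡⟨ cong (λ x → a j * (- + m - + d) + a j * (x - + j - + 1)) (ℤ.pos-+ r m) ⟩
      a j * (- + m - + d) + a j * (+ r + + m - + j - + 1)
        ≡⟨ expand (a j) (+ m) (+ d) (+ r) (+ j) ⟩
      + r * a j - a j * (+ 1 + (+ d + + j))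
        ≡⟨ cong (λ x → + r * a j - a j * (+ 1 + x)) d+j≡p-1 ⟩
      + r * a j - a j * + p
        ≈⟨ +-cong (≈-refl {+ r * a j}) (-‿cong (*-congˡ (a j) p≈0)) ⟩
      + r * a j - a j * + 0
        ≡⟨ vanish (+ r * a j) (a j) ⟩
      + r * a j
        ∎
      where
      open ≈-Reasoning
      j≤p-1 = ℕ.s≤s⁻¹ j<p
      d = p-1 ∸ j
      d+j≡p-1 : + d + + j ≡ + p-1
      d+j≡p-1 = trans (sym (ℤ.pos-+ d j)) (cong +_ (ℕ.m∸n+n≡m j≤p-1))
      expand : ∀ A M D R J → A * (- M - D) + A * (R + M - J - + 1) ≡ R * A - A * (+ 1 + (D + J))
      expand = solve-∀
      vanish : ∀ x y → x - y * + 0 ≡ x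
      vanish = solve-∀

    -- Summation by parts; the boundary terms b 0 · Q n 0 and b p · Q n p vanish mod p.
    L-suc : ∀ n i → L (suc n) i ≈ + r * L n i
    L-suc n i = begin
      L (suc n) i
        ≡⟨ sumBelow-cong p (λ j _ → trans (cong (a j *_) (Q-suc n j i)) (distrib (a j) _ (c j) _)) ⟩
      sumBelow p (λ j → g (suc j) + h j)
        ≡⟨ sumBelow-+ p (λ j → g (suc j)) h ⟩
      sumBelow p (λ j → g (suc j)) + sumBelow p h
        ≡⟨ cong (_+ sumBelow p h) (sumBelow-shift p g) ⟩
      sumBelow p g + g p - g 0 + sumBelow p h
        ≈⟨ +-cong (+-cong (+-cong (≈-refl {sumBelow p g}) g[p]≈0) (-‿cong g[0]≈0)) (≈-refl {sumBelow p h}) ⟩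
      sumBelow p g + + 0 - + 0 + sumBelow p h
        ≡⟨ cong (_+ sumBelow p h) (vanish (sumBelow p g)) ⟩
      sumBelow p g + sumBelow p h
        ≡⟨ sumBelow-+ p g h ⟨
      sumBelow p (λ j → g j + h j)
        ≈⟨ sumBelow-cong≈ p term ⟩
      sumBelow p (λ j → + r * (a j * Q n j i))
        ≡⟨ sumBelow-*ˡ p (+ r) _ ⟩
      + r * L n i
        ∎
      where
      open ≈-Reasoning
      g h : ℕ → ℤ
      g j = b j * Q n j i
      h j = a j * c j * Q n j i
      g[p]≈0 : g p ≈ + 0
      g[p]≈0 = ≈-trans (*-congˡ (b p) (Q[p]≈0 n i)) (≈-reflexive (ℤ.*-zeroʳ (b p)))
      g[0]≈0 : g 0 ≈ + 0
      g[0]≈0 = *-congʳ (Q n 0 i) (fall-neg[p]≈0 m)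
      distrib : ∀ a x c y → a * (x + c * y) ≡ a * x + a * c * y
      distrib = solve-∀
      vanish : ∀ s → s + + 0 - + 0 ≡ s
      vanish = solve-∀
      factor : ∀ b a c q → b * q + a * c * q ≡ (b + a * c) * q
      factor = solve-∀
      term : ∀ j → j < p → g j + h j ≈ + r * (a j * Q n j i)
      term j j<p = begin
        g j + h j                  ≡⟨ factor (b j) (a j) (c j) (Q n j i) ⟩
        (b j + a j * c j) * Q n j i ≈⟨ *-congʳ (Q n j i) (b+ac≈ra j<p) ⟩
        + r * a j * Q n j i        ≡⟨ ℤ.*-assoc (+ r) (a j) (Q n j i) ⟩
        + r * (a j * Q n j i)      ∎

    L-zero : ∀ i → L 0 i ≈ - Tpoly p-1 m i
    L-zero i = begin
      L 0 i
        ≡⟨ sumBelow-cong p (λ j _ → cong (a j *_) (Q-zero j)) ⟩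
      sumBelow p (λ j → a j * (+ (j C i) * + (j !)))
        ≈⟨ sumBelow-cong≈ p (λ j j<p → term j (ℕ.s≤s⁻¹ j<p)) ⟩
      sumBelow p (λ j → -1ℤ * (+ (j C i) * + multichoose m (p-1 ∸ j)))
        ≡⟨ trans (sumBelow-*ˡ p -1ℤ _) (ℤ.-1*i≡-i _) ⟩
      - sumBelow p (λ j → + (j C i) * + multichoose m (p-1 ∸ j))
        ≡⟨ cong -_ (sumBelow-reverse p _) ⟩
      - sumBelow p (λ t → + ((p-1 ∸ t) C i) * + multichoose m (p-1 ∸ (p-1 ∸ t)))
        ≡⟨ cong -_ (sumBelow-cong p reindex) ⟩
      - sumBelow p (λ t → + ((p-1 ∸ t) C i) * + multichoose m t)
        ≡⟨ cong -_ (trans (multichoose-convolution m p-1 i) (sym (Tpoly-coefficient p-1 m i))) ⟩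
      - Tpoly p-1 m i
        ∎
      where
      open ≈-Reasoning
      reindex : ∀ t → t < p →
        + ((p-1 ∸ t) C i) * + multichoose m (p-1 ∸ (p-1 ∸ t)) ≡ + ((p-1 ∸ t) C i) * + multichoose m t
      reindex t t<p = cong (λ x → + ((p-1 ∸ t) C i) * + multichoose m x) (ℕ.m∸[m∸n]≡n (ℕ.s≤s⁻¹ t<p))
      Q-zero : ∀ j → Q 0 j i ≡ + (j C i) * + (j !)
      Q-zero j = trans (pmul-constantʳ (xPlus1Pow j) (fubini 0 (r ℕ.+ m) j) i (λ _ → refl))
                       (cong (+ (j C i) *_) (fubini-initial (r ℕ.+ m) j))
      regroup : ∀ a C F → a * (C * F) ≡ a * F * C
      regroup = solve-∀
      negate : ∀ M C → - M * C ≡ -1ℤ * (C * M)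
      negate = solve-∀
      term : ∀ j → j ≤ p-1 → a j * (+ (j C i) * + (j !)) ≈ -1ℤ * (+ (j C i) * + multichoose m (p-1 ∸ j))
      term j j≤p-1 = begin
        a j * (+ (j C i) * + (j !))
          ≡⟨ regroup (a j) (+ (j C i)) (+ (j !)) ⟩
        a j * + (j !) * + (j C i)
          ≡⟨ cong (λ x → a j * + (x !) * + (j C i)) (ℕ.m∸[m∸n]≡n j≤p-1) ⟨
        a j * + ((p-1 ∸ (p-1 ∸ j)) !) * + (j C i)
          ≈⟨ *-congʳ (+ (j C i)) (fall-neg*factorial≈-multichoose m (ℕ.m∸n≤m p-1 j)) ⟩
        - + multichoose m (p-1 ∸ j) * + (j C i)
          ≡⟨ negate (+ multichoose m (p-1 ∸ j)) (+ (j C i)) ⟩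
        -1ℤ * (+ (j C i) * + multichoose m (p-1 ∸ j))
          ∎

    L≈-r^n*T : ∀ n i → L n i ≈ - + (r ℕ.^ n) * Tpoly p-1 m i
    L≈-r^n*T zero    i = ≈-trans (L-zero i) (≈-reflexive (sym (ℤ.-1*i≡-i _)))
    L≈-r^n*T (suc n) i = begin
      L (suc n) i
        ≈⟨ L-suc n i ⟩
      + r * L n i
        ≈⟨ *-congˡ (+ r) (L≈-r^n*T n i) ⟩
      + r * (- + (r ℕ.^ n) * Tpoly p-1 m i)
        ≡⟨ regroup (+ r) (+ (r ℕ.^ n)) (Tpoly p-1 m i) ⟩
      - (+ r * + (r ℕ.^ n)) * Tpoly p-1 m i
        ≡⟨ cong (λ x → - x * Tpoly p-1 m i) (ℤ.pos-* r (r ℕ.^ n)) ⟨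
      - + (r ℕ.^ suc n) * Tpoly p-1 m i
        ∎
      where
      open ≈-Reasoning
      regroup : ∀ r x t → r * (- x * t) ≡ - (r * x) * t
      regroup = solve-∀

open import Data.Nat using (ℕ; zero; suc; _∸_; _+_; _^_)
open import Data.Nat.Primality using (Prime; ¬prime[0])
open import Data.Integer using (+_; -_)
open import Relation.Nullary using (contradiction)

theorem18 : (n m r p : ℕ) → Prime p →
    psumBelow p (λ k → pscale (fall (- (+ m)) (p ∸ 1 ∸ k)) (pmul (xPlus1Pow k) (fubini n (r + m) k)))
    ≡ₚ pscale (- (+ (r ^ n))) (Tpoly (p ∸ 1) m) [mod p ]
theorem18 n m r zero      p-prime   = contradiction p-prime ¬prime[0]
theorem18 n m r (suc p-1) p-prime i = ≈⇒∣ᵤ (L≈-r^n*T n i)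
  where
  open Proof.Modulo (suc p-1) using (≈⇒∣ᵤ)
  open Proof.FubiniCongruence p-1 p-prime m r using (L≈-r^n*T)
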